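{- Let $n\ge2$, $G=SL(n+1,\mathbb{R})$, let $\lambda$ be a non-zero dominant weight (the highest weight of a non-trivial irreducible representation $\tau$ of $G$), let $\beta=\sum_{i=1}^n\alpha_i$ be the highest root, $\theta=\frac12\beta$ and $\psi=2\rho-\theta$. With $$m_1=\min_{1\le j\le n}\frac{\lambda(\tilde\beta_j)}{2\rho(\tilde\beta_j)},\quad m_1'=\min_{1\le j\le n}\frac{\lambda(\tilde\beta_j)}{\psi(\tilde\beta_j)},\quad\kappa_0=\frac{1}{n(n+1)(n+2)},$$ the exponent $\kappa=2n\left(1-\frac{m_1}{m_1'}\right)\kappa_0$ satisfies $\kappa\le\kappa_0$.
   Context: $\mathfrak a$ is the space of real traceless diagonal $(n+1)\times(n+1)$ matrices $H=\mathrm{diag}(h_1,\dots,h_{n+1})$; simple roots $\alpha_i(H)=h_i-h_{i+1}$ (so $\beta(H)=h_1-h_{n+1}$); $\tilde\beta_1,\dots,\tilde\beta_n\in\mathfrak a$ with $\alpha_i(\tilde\beta_j)=\delta_{ij}$; fundamental weights $\lambda_i(H)=h_1+\dots+h_i$; dominant weights are $\sum q_i\lambda_i$ with $q_i\in\mathbb{Z}_{\ge0}$; $\rho=\sum_i\lambda_i$, so $2\rho(\tilde\beta_j)=j(n+1-j)$. -}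

module Defs where

open import Data.Nat as ℕ using (ℕ; zero; suc; _≤ᵇ_)
open import Data.Integer as ℤ using (+_; +[1+_]; -[1+_])
open import Data.Fin as Fin using (Fin; toℕ; inject₁)
open import Data.Bool using (if_then_else_)
open import Relation.Nullary using (yes; no)
open import Data.Rational as ℚ using (ℚ; mkℚ; 0ℚ; 1ℚ; ½; _+_; _*_; _-_; _÷_; _⊓_; _/_)

fromℕ : ℕ → ℚ
fromℕ k = + k / 1

-- total division; x ÷₀ 0 = 0 (only ever used with non-zero denominators)
_÷₀_ : ℚ → ℚ → ℚ
x ÷₀ mkℚ (+ zero) _ _ = 0ℚ
x ÷₀ y@(mkℚ +[1+ _ ] _ _) = x ÷ y
x ÷₀ y@(mkℚ -[1+ _ ] _ _) = x ÷ y

sumFin : ∀ {n} → (Fin n → ℚ) → ℚ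
sumFin {zero} f = 0ℚ
sumFin {suc n} f = f Fin.zero + sumFin (λ k → f (Fin.suc k))

-- minimum over Fin n (value 0 for n = 0, never used since n ≥ 2)
minFin : ∀ {n} → (Fin n → ℚ) → ℚ
minFin {zero} f = 0ℚ
minFin {suc zero} f = f Fin.zero
minFin {suc (suc n)} f = f Fin.zero ⊓ minFin (λ k → f (Fin.suc k))

δ : ∀ {n} → Fin n → Fin n → ℚ
δ i j with i Fin.≟ j
... | yes _ = 1ℚ
... | no _ = 0ℚ


-- 𝔞 ⊆ diagonal (n+1)×(n+1) matrices, H = diag(h_1,…,h_{n+1}) as a function
-- Fin (suc n) → ℚ (entry k ↦ h_{k+1}).  Tracelessness is a separate predicate.
Diag : ℕ → Set
Diag n = Fin (suc n) → ℚ

trace : ∀ {n} → Diag n → ℚ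
trace H = sumFin H

-- simple roots: α i (H) = h_i - h_{i+1}, index i : Fin n stands for α_{i+1}
α : ∀ {n} → Fin n → Diag n → ℚ
α i H = H (inject₁ i) - H (Fin.suc i)

β : ∀ {n} → Diag n → ℚ
β H = sumFin (λ i → α i H)

-- fundamental weights: λfund i H = h_1 + … + h_{i+1}  (index i stands for λ_{i+1})
λfund : ∀ {n} → Fin n → Diag n → ℚ
λfund i H = sumFin (λ k → if toℕ k ≤ᵇ toℕ i then H k else 0ℚ)

weight : ∀ {n} → (Fin n → ℕ) → Diag n → ℚ
weight q H = sumFin (λ i → fromℕ (q i) * λfund i H)

twoρ : ∀ {n} → Diag n → ℚ
twoρ H = fromℕ 2 * sumFin (λ i → λfund i H)

θ : ∀ {n} → Diag n → ℚ
θ H = ½ * β H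

ψ : ∀ {n} → Diag n → ℚ
ψ H = twoρ H - θ H

-- the quantities of the proposition, for weight q and dual basis βt (βt j = β̃_{j+1})
m₁ : ∀ {n} → (Fin n → ℕ) → (Fin n → Diag n) → ℚ
m₁ q βt = minFin (λ j → weight q (βt j) ÷₀ twoρ (βt j))

m₁′ : ∀ {n} → (Fin n → ℕ) → (Fin n → Diag n) → ℚ
m₁′ q βt = minFin (λ j → weight q (βt j) ÷₀ ψ (βt j))

κ₀ : ℕ → ℚ
κ₀ n = 1ℚ ÷₀ fromℕ (n ℕ.* (suc n) ℕ.* (suc (suc n)))

κ : ∀ n → (Fin n → ℕ) → (Fin n → Diag n) → ℚ
κ n q βt = fromℕ (2 ℕ.* n) * (1ℚ - (m₁ q βt ÷₀ m₁′ q βt)) * κ₀ n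

-- Write A_j = λ(β̃_j), C_j = 2ρ(β̃_j) and P_j = ψ(β̃_j).  Three facts about the
-- dual basis β̃_j (traceless, α_i(β̃_j) = δ_ij) carry the proof:
--   (1) β(β̃_j) = 1, hence P_j = C_j - ½;
--   (2) on traceless elements 2ρ = Σ_i i(n+1-i) α_i, hence C_j = j(n+1-j) ≥ n;
--   (3) fundamental weights are positive on a traceless element of the closed
--       Weyl chamber which is not on all walls, hence A_j > 0 whenever λ ≠ 0.
-- The rest is an elementary estimate on a ratio of minima: if j₀ minimises A/C,
-- then m₁′ P_{j₀} ≤ A_{j₀} = m₁ C_{j₀}, so C_{j₀} - ½ ≤ (m₁/m₁′) C_{j₀}, i.e.
-- 1 - m₁/m₁′ ≤ 1/(2C_{j₀}) ≤ 1/(2n); multiplying by κ₀ ≥ 0 gives κ ≤ κ₀.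

module Submission where

open import Defs
open import Data.Nat using (ℕ; _≤_)
open import Data.Fin using (Fin)
open import Data.Product using (∃)
open import Relation.Binary.PropositionalEquality using (_≡_; _≢_)
open import Data.Rational using (0ℚ)
open import Data.Rational as ℚ using ()

open import Data.Nat as N using (zero; suc; z≤n; s≤s)
import Data.Nat.Properties as NP
import Data.Nat.Coprimality as Cop
import Data.Integer as Z
import Data.Integer.Properties as ZP
open import Data.Fin as F using (toℕ; inject₁)
import Data.Fin.Properties as FP
open import Data.Rational as Q using (ℚ; mkℚ; 1ℚ; ½; _+_; _*_; _-_; -_)
import Data.Rational.Properties as QP
import Data.Rational.Unnormalised as U
import Data.Rational.Unnormalised.Properties as UP
open import Data.Rational.Solver using (module +-*-Solver)
open +-*-Solver
open import Relation.Binary.PropositionalEquality using (refl; sym; trans; cong; cong₂; subst; subst₂; module ≡-Reasoning)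
open import Relation.Nullary using (yes; no)
open import Relation.Nullary.Decidable using (toWitness)
open import Data.Bool using (Bool; true; false; if_then_else_; T; not)
open import Data.Product using (_,_)
open import Data.Sum using (inj₁; inj₂)
open import Data.Empty using (⊥-elim)
open import Data.Unit using (tt)

fromℕ≡mkℚ : ∀ k → fromℕ k ≡ mkℚ (Z.+ k) 0 (Cop.sym (Cop.1-coprimeTo k))
fromℕ≡mkℚ k = QP.normalize-coprime (Cop.sym (Cop.1-coprimeTo k))

-- fromℕ is additive; checked on unnormalised rationals, where it is integer arithmetic.
fromℕ-+ : ∀ a b → fromℕ (a N.+ b) ≡ fromℕ a + fromℕ b
fromℕ-+ a b = QP.toℚᵘ-injective (UP.≃-trans unnormalised (UP.≃-sym (QP.toℚᵘ-homo-+ (fromℕ a) (fromℕ b))))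
  where
  unnormalised : Q.toℚᵘ (fromℕ (a N.+ b)) U.≃ (Q.toℚᵘ (fromℕ a) U.+ Q.toℚᵘ (fromℕ b))
  unnormalised rewrite fromℕ≡mkℚ (a N.+ b) | fromℕ≡mkℚ a | fromℕ≡mkℚ b = U.*≡* (begin
      Z.+ (a N.+ b) Z.* Z.+ 1                 ≡⟨ ZP.*-identityʳ _ ⟩
      Z.+ (a N.+ b)                           ≡⟨ ZP.pos-+ a b ⟩
      Z.+ a Z.+ Z.+ b                         ≡⟨ cong₂ Z._+_ (sym (ZP.*-identityʳ (Z.+ a))) (sym (ZP.*-identityʳ (Z.+ b))) ⟩
      Z.+ a Z.* Z.+ 1 Z.+ Z.+ b Z.* Z.+ 1     ≡⟨ sym (ZP.*-identityʳ _) ⟩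
      (Z.+ a Z.* Z.+ 1 Z.+ Z.+ b Z.* Z.+ 1) Z.* Z.+ 1 ∎)
    where open ≡-Reasoning

fromℕ-suc : ∀ k → fromℕ (suc k) ≡ 1ℚ + fromℕ k
fromℕ-suc = fromℕ-+ 1

fromℕ-* : ∀ a b → fromℕ (a N.* b) ≡ fromℕ a * fromℕ b
fromℕ-* zero b = sym (QP.*-zeroˡ (fromℕ b))
fromℕ-* (suc a) b = begin
  fromℕ (b N.+ a N.* b)        ≡⟨ fromℕ-+ b (a N.* b) ⟩
  fromℕ b + fromℕ (a N.* b)    ≡⟨ cong (fromℕ b +_) (fromℕ-* a b) ⟩
  fromℕ b + fromℕ a * fromℕ b  ≡⟨ solve 2 (λ x y → y :+ x :* y := (con 1ℚ :+ x) :* y) refl (fromℕ a) (fromℕ b) ⟩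
  (1ℚ + fromℕ a) * fromℕ b     ≡⟨ cong (_* fromℕ b) (sym (fromℕ-suc a)) ⟩
  fromℕ (suc a) * fromℕ b      ∎
  where open ≡-Reasoning

fromℕ-nonneg : ∀ k → 0ℚ Q.≤ fromℕ k
fromℕ-nonneg k = subst (0ℚ Q.≤_) (sym (fromℕ≡mkℚ k)) (QP.nonNegative⁻¹ _)

fromℕ-pos : ∀ k → k ≢ 0 → 0ℚ Q.< fromℕ k
fromℕ-pos zero k≢0 = ⊥-elim (k≢0 refl)
fromℕ-pos (suc k) _ = subst (0ℚ Q.<_) (sym (fromℕ≡mkℚ (suc k))) (QP.positive⁻¹ _)

fromℕ-suc-≥1 : ∀ k → 1ℚ Q.≤ fromℕ (suc k)
fromℕ-suc-≥1 k = subst₂ Q._≤_ (QP.+-identityʳ 1ℚ) (sym (fromℕ-suc k)) (QP.+-monoʳ-≤ 1ℚ (fromℕ-nonneg k))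

*-pos : ∀ {a b} → 0ℚ Q.< a → 0ℚ Q.< b → 0ℚ Q.< a * b
*-pos {a} {b} 0<a 0<b = QP.positive⁻¹ (a * b) {{QP.pos*pos⇒pos a {{Q.positive 0<a}} b {{Q.positive 0<b}}}}

*-nonneg : ∀ {a b} → 0ℚ Q.≤ a → 0ℚ Q.≤ b → 0ℚ Q.≤ a * b
*-nonneg {a} {b} 0≤a 0≤b = QP.nonNegative⁻¹ (a * b) {{QP.nonNeg*nonNeg⇒nonNeg a {{Q.nonNegative 0≤a}} b {{Q.nonNegative 0≤b}}}}

0≤y-x⇒x≤y : ∀ x y → 0ℚ Q.≤ y - x → x Q.≤ y
0≤y-x⇒x≤y x y h = subst₂ Q._≤_ (QP.+-identityʳ x) (solve 2 (λ x y → x :+ (y :- x) := y) refl x y) (QP.+-monoʳ-≤ x h)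

x≤y⇒0≤y-x : ∀ x y → x Q.≤ y → 0ℚ Q.≤ y - x
x≤y⇒0≤y-x x y h = subst (Q._≤ y - x) (QP.+-inverseʳ x) (QP.+-monoˡ-≤ (- x) h)

1≤x⇒0<x-½ : ∀ x → 1ℚ Q.≤ x → 0ℚ Q.< x - ½
1≤x⇒0<x-½ x 1≤x = QP.<-≤-trans (toWitness {a? = 0ℚ QP.<? 1ℚ - ½} tt) (QP.+-monoˡ-≤ (- ½) 1≤x)

÷₀-cancel : ∀ x y → 0ℚ Q.< y → (x ÷₀ y) * y ≡ x
÷₀-cancel x y@(mkℚ Z.+[1+ _ ] _ _) _ = trans (QP.*-assoc x (Q.1/ y) y) (trans (cong (x *_) (QP.*-inverseˡ y)) (QP.*-identityʳ x))
÷₀-cancel x (mkℚ (Z.+ 0) _ _) 0<y = ⊥-elim (Z.Positive.pos (Q.positive 0<y))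
÷₀-cancel x (mkℚ Z.-[1+ _ ] _ _) 0<y = ⊥-elim (Z.Positive.pos (Q.positive 0<y))

÷₀-pos : ∀ x y → 0ℚ Q.< x → 0ℚ Q.< y → 0ℚ Q.< x ÷₀ y
÷₀-pos x y@(mkℚ Z.+[1+ _ ] _ _) 0<x _ = *-pos 0<x (QP.positive⁻¹ (Q.1/ y))
÷₀-pos x (mkℚ (Z.+ 0) _ _) _ 0<y = ⊥-elim (Z.Positive.pos (Q.positive 0<y))
÷₀-pos x (mkℚ Z.-[1+ _ ] _ _) _ 0<y = ⊥-elim (Z.Positive.pos (Q.positive 0<y))

÷₀-nonneg : ∀ x y → 0ℚ Q.≤ x → 0ℚ Q.≤ y → 0ℚ Q.≤ x ÷₀ y
÷₀-nonneg x y@(mkℚ Z.+[1+ _ ] _ _) 0≤x _ = *-nonneg 0≤x (QP.nonNegative⁻¹ (Q.1/ y))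
÷₀-nonneg x (mkℚ (Z.+ 0) _ _) _ _ = QP.≤-refl
÷₀-nonneg x (mkℚ Z.-[1+ _ ] _ _) _ 0≤y = ⊥-elim (Z.NonNegative.nonNeg (Q.nonNegative 0≤y))

sumFin-cong : ∀ {n} {f g : Fin n → ℚ} → (∀ i → f i ≡ g i) → sumFin f ≡ sumFin g
sumFin-cong {zero} _ = refl
sumFin-cong {suc n} f≡g = cong₂ _+_ (f≡g F.zero) (sumFin-cong (λ i → f≡g (F.suc i)))

sumFin-+ : ∀ {n} (f g : Fin n → ℚ) → sumFin (λ i → f i + g i) ≡ sumFin f + sumFin g
sumFin-+ {zero} f g = refl
sumFin-+ {suc n} f g =
  trans (cong ((f F.zero + g F.zero) +_) (sumFin-+ (λ i → f (F.suc i)) (λ i → g (F.suc i))))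
        (solve 4 (λ a b c d → (a :+ b) :+ (c :+ d) := (a :+ c) :+ (b :+ d)) refl
           (f F.zero) (g F.zero) (sumFin (λ i → f (F.suc i))) (sumFin (λ i → g (F.suc i))))

sumFin-const : ∀ {n} c → sumFin {n} (λ _ → c) ≡ fromℕ n * c
sumFin-const {zero} c = sym (QP.*-zeroˡ c)
sumFin-const {suc n} c = trans (cong (c +_) (sumFin-const {n} c))
  (trans (solve 2 (λ c a → c :+ a :* c := (con 1ℚ :+ a) :* c) refl c (fromℕ n)) (cong (_* c) (sym (fromℕ-suc n))))

δ-suc : ∀ {n} (i j : Fin n) → δ (F.suc i) (F.suc j) ≡ δ i j
δ-suc i j with i F.≟ j | F.suc i F.≟ F.suc j
... | yes _ | yes _ = refl
... | no _ | no _ = refl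
... | yes i≡j | no si≢sj = ⊥-elim (si≢sj (cong F.suc i≡j))
... | no i≢j | yes si≡sj = ⊥-elim (i≢j (FP.suc-injective si≡sj))

δ-nonneg : ∀ {n} (i j : Fin n) → 0ℚ Q.≤ δ i j
δ-nonneg i j with i F.≟ j
... | yes _ = QP.nonNegative⁻¹ 1ℚ
... | no _ = QP.≤-refl

δ-refl : ∀ {n} (j : Fin n) → δ j j ≡ 1ℚ
δ-refl j with j F.≟ j
... | yes _ = refl
... | no j≢j = ⊥-elim (j≢j refl)

sumFin-δ : ∀ {n} (f : Fin n → ℚ) (j : Fin n) → sumFin (λ i → f i * δ i j) ≡ f j
sumFin-δ {suc n} f F.zero =
  trans (cong₂ _+_ (QP.*-identityʳ (f F.zero))
                   (trans (sumFin-cong (λ i → QP.*-zeroʳ (f (F.suc i)))) (sumFin-const {n} 0ℚ)))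
        (trans (cong (f F.zero +_) (QP.*-zeroʳ (fromℕ n))) (QP.+-identityʳ (f F.zero)))
sumFin-δ {suc n} f (F.suc j) =
  trans (cong₂ _+_ (QP.*-zeroʳ (f F.zero))
                   (trans (sumFin-cong (λ i → cong (f (F.suc i) *_) (δ-suc i j))) (sumFin-δ (λ i → f (F.suc i)) j)))
        (QP.+-identityˡ (f (F.suc j)))

sumFin-nonneg : ∀ {n} (f : Fin n → ℚ) → (∀ i → 0ℚ Q.≤ f i) → 0ℚ Q.≤ sumFin f
sumFin-nonneg {zero} f _ = QP.≤-refl
sumFin-nonneg {suc n} f 0≤f = QP.+-mono-≤ (0≤f F.zero) (sumFin-nonneg (λ i → f (F.suc i)) (λ i → 0≤f (F.suc i)))

sumFin-pos : ∀ {n} (f : Fin n → ℚ) → (∀ i → 0ℚ Q.≤ f i) → (k : Fin n) → 0ℚ Q.< f k → 0ℚ Q.< sumFin f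
sumFin-pos {suc n} f 0≤f F.zero 0<fk = QP.+-mono-<-≤ 0<fk (sumFin-nonneg (λ i → f (F.suc i)) (λ i → 0≤f (F.suc i)))
sumFin-pos {suc n} f 0≤f (F.suc k) 0<fk = QP.+-mono-≤-< (0≤f F.zero) (sumFin-pos (λ i → f (F.suc i)) (λ i → 0≤f (F.suc i)) k 0<fk)

sumFin-nonpos : ∀ {n} (f : Fin n → ℚ) → (∀ i → f i Q.≤ 0ℚ) → sumFin f Q.≤ 0ℚ
sumFin-nonpos {zero} f _ = QP.≤-refl
sumFin-nonpos {suc n} f f≤0 = QP.+-mono-≤ (f≤0 F.zero) (sumFin-nonpos (λ i → f (F.suc i)) (λ i → f≤0 (F.suc i)))

sumFin-neg : ∀ {n} (f : Fin n → ℚ) → (∀ i → f i Q.≤ 0ℚ) → (k : Fin n) → f k Q.< 0ℚ → sumFin f Q.< 0ℚ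
sumFin-neg {suc n} f f≤0 F.zero fk<0 = QP.+-mono-<-≤ fk<0 (sumFin-nonpos (λ i → f (F.suc i)) (λ i → f≤0 (F.suc i)))
sumFin-neg {suc n} f f≤0 (F.suc k) fk<0 = QP.+-mono-≤-< (f≤0 F.zero) (sumFin-neg (λ i → f (F.suc i)) (λ i → f≤0 (F.suc i)) k fk<0)

restrict : ∀ {n} → (Fin n → Bool) → (Fin n → ℚ) → Fin n → ℚ
restrict b f k = if b k then f k else 0ℚ

restrict-selected : ∀ {n} (b : Fin n → Bool) (f : Fin n → ℚ) k → T (b k) → restrict b f k ≡ f k
restrict-selected b f k selected with b k
... | true = refl

sumFin-restrict : ∀ {n} (b : Fin n → Bool) (f : Fin n → ℚ) →
  sumFin (restrict b f) + sumFin (restrict (λ k → not (b k)) f) ≡ sumFin f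
sumFin-restrict b f = trans (sym (sumFin-+ (restrict b f) (restrict (λ k → not (b k)) f))) (sumFin-cong split)
  where
  split : ∀ k → restrict b f k + restrict (λ k → not (b k)) f k ≡ f k
  split k with b k
  ... | true = QP.+-identityʳ (f k)
  ... | false = QP.+-identityˡ (f k)

restrict-nonneg : ∀ {n} (b : Fin n → Bool) (f : Fin n → ℚ) → (∀ k → T (b k) → 0ℚ Q.≤ f k) → ∀ k → 0ℚ Q.≤ restrict b f k
restrict-nonneg b f 0≤f k with b k in bk
... | true = 0≤f k (subst T (sym bk) tt)
... | false = QP.≤-refl

restrict-nonpos : ∀ {n} (b : Fin n → Bool) (f : Fin n → ℚ) → (∀ k → T (b k) → f k Q.≤ 0ℚ) → ∀ k → restrict b f k Q.≤ 0ℚ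
restrict-nonpos b f f≤0 k with b k in bk
... | true = f≤0 k (subst T (sym bk) tt)
... | false = QP.≤-refl

minFin-≤ : ∀ {n} (f : Fin n → ℚ) j → minFin f Q.≤ f j
minFin-≤ {suc zero} f F.zero = QP.≤-refl
minFin-≤ {suc (suc n)} f F.zero = QP.p⊓q≤p (f F.zero) _
minFin-≤ {suc (suc n)} f (F.suc j) = QP.≤-trans (QP.p⊓q≤q (f F.zero) _) (minFin-≤ (λ k → f (F.suc k)) j)

minFin-attained : ∀ {n} (f : Fin (suc n) → ℚ) → ∃ λ j → minFin f ≡ f j
minFin-attained {zero} f = F.zero , refl
minFin-attained {suc n} f with QP.⊓-sel (f F.zero) (minFin (λ k → f (F.suc k)))
... | inj₁ e = F.zero , e
... | inj₂ e with minFin-attained (λ k → f (F.suc k))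
...   | j , e′ = F.suc j , trans e e′

-- Expansion of λ₁ and 2ρ in simple roots

tail : ∀ {n} → Diag (suc n) → Diag n
tail H k = H (F.suc k)

inSimpleRoots : ∀ {n} → (Fin n → ℚ) → Diag n → ℚ
inSimpleRoots c H = sumFin (λ i → c i * α i H)

inSimpleRoots-+ : ∀ {n} (c d : Fin n → ℚ) (H : Diag n) →
  inSimpleRoots (λ i → c i + d i) H ≡ inSimpleRoots c H + inSimpleRoots d H
inSimpleRoots-+ c d H =
  trans (sumFin-cong (λ i → QP.*-distribʳ-+ (α i H) (c i) (d i))) (sumFin-+ (λ i → c i * α i H) (λ i → d i * α i H))

-- λ₁-coeff n i = n - i (0-indexed), the coefficients of (n+1)λ₁ - trace
λ₁-coeff : ∀ n → Fin n → ℚ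
λ₁-coeff (suc n) F.zero = fromℕ (suc n)
λ₁-coeff (suc n) (F.suc i) = λ₁-coeff n i

-- ρ-coeff n i = (i+1)(n-i) (0-indexed), the coefficients of 2ρ
ρ-coeff : ∀ n → Fin n → ℚ
ρ-coeff (suc n) F.zero = fromℕ (suc n)
ρ-coeff (suc n) (F.suc i) = ρ-coeff n i + λ₁-coeff n i

λ₁-expansion : ∀ {n} (H : Diag n) → inSimpleRoots (λ₁-coeff n) H ≡ fromℕ (suc n) * H F.zero - trace H
λ₁-expansion {zero} H = solve 1 (λ h → con 0ℚ := con 1ℚ :* h :- (h :+ con 0ℚ)) refl (H F.zero)
λ₁-expansion {suc n} H =
  trans (cong (fromℕ (suc n) * α F.zero H +_) (λ₁-expansion (tail H)))
  (trans (solve 4 (λ a h₀ h₁ t → a :* (h₀ :- h₁) :+ (a :* h₁ :- t) := (con 1ℚ :+ a) :* h₀ :- (h₀ :+ t)) refl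
           (fromℕ (suc n)) (H F.zero) (H (F.suc F.zero)) (trace (tail H)))
         (cong (λ a → a * H F.zero - trace H) (sym (fromℕ-suc (suc n)))))

λfund-suc : ∀ {n} (i : Fin n) (H : Diag (suc n)) → λfund (F.suc i) H ≡ H F.zero + λfund i (tail H)
λfund-suc i H = cong (H F.zero +_) (sumFin-cong (λ k → cong (λ b → if b then H (F.suc k) else 0ℚ) (shift (toℕ k) (toℕ i))))
  where
  shift : ∀ a b → (suc a N.≤ᵇ suc b) ≡ (a N.≤ᵇ b)
  shift zero b = refl
  shift (suc a) b = refl

sumλ-suc : ∀ {n} (H : Diag (suc n)) →
  sumFin (λ i → λfund i H) ≡ fromℕ (suc n) * H F.zero + sumFin (λ i → λfund i (tail H))
sumλ-suc {n} H = begin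
  λfund F.zero H + sumFin (λ i → λfund (F.suc i) H)
    ≡⟨ cong₂ _+_ λ₁≡h₁ (trans (sumFin-cong (λ i → λfund-suc i H)) (sumFin-+ (λ _ → H F.zero) (λ i → λfund i (tail H)))) ⟩
  H F.zero + (sumFin {n} (λ _ → H F.zero) + S)
    ≡⟨ cong (λ x → H F.zero + (x + S)) (sumFin-const {n} (H F.zero)) ⟩
  H F.zero + (fromℕ n * H F.zero + S)
    ≡⟨ solve 3 (λ h a s → h :+ (a :* h :+ s) := (con 1ℚ :+ a) :* h :+ s) refl (H F.zero) (fromℕ n) S ⟩
  (1ℚ + fromℕ n) * H F.zero + S
    ≡⟨ cong (λ x → x * H F.zero + S) (sym (fromℕ-suc n)) ⟩
  fromℕ (suc n) * H F.zero + S ∎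
  where
  open ≡-Reasoning
  S : ℚ
  S = sumFin (λ i → λfund i (tail H))
  λ₁≡h₁ : λfund F.zero H ≡ H F.zero
  λ₁≡h₁ = trans (cong (H F.zero +_) (trans (sumFin-const {suc n} 0ℚ) (QP.*-zeroʳ (fromℕ (suc n)))))
                (QP.+-identityʳ (H F.zero))

twoρ-expansion : ∀ {n} (H : Diag n) → twoρ H ≡ inSimpleRoots (ρ-coeff n) H + fromℕ n * trace H
twoρ-expansion {zero} H = solve 1 (λ h → con (fromℕ 2) :* con 0ℚ := con 0ℚ :+ con (fromℕ 0) :* (h :+ con 0ℚ)) refl (H F.zero)
twoρ-expansion {suc n} H = begin
    twoρ H
  ≡⟨ cong (fromℕ 2 *_) (sumλ-suc H) ⟩
    fromℕ 2 * (N₁ * h₀ + sumFin (λ i → λfund i (tail H)))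
  ≡⟨ QP.*-distribˡ-+ (fromℕ 2) (N₁ * h₀) _ ⟩
    fromℕ 2 * (N₁ * h₀) + twoρ (tail H)
  ≡⟨ cong (fromℕ 2 * (N₁ * h₀) +_) (twoρ-expansion (tail H)) ⟩
    fromℕ 2 * (N₁ * h₀) + (R + fromℕ n * t)
  ≡⟨ cong (λ x → fromℕ 2 * (x * h₀) + (R + fromℕ n * t)) (fromℕ-suc n) ⟩
    fromℕ 2 * ((1ℚ + fromℕ n) * h₀) + (R + fromℕ n * t)
  ≡⟨ solve 5 (λ a h₀ h₁ t r → con (fromℕ 2) :* ((con 1ℚ :+ a) :* h₀) :+ (r :+ a :* t)
        := (con 1ℚ :+ a) :* (h₀ :- h₁) :+ (r :+ ((con 1ℚ :+ a) :* h₁ :- t)) :+ (con 1ℚ :+ a) :* (h₀ :+ t)) refl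
        (fromℕ n) h₀ h₁ t R ⟩
    (1ℚ + fromℕ n) * (h₀ - h₁) + (R + ((1ℚ + fromℕ n) * h₁ - t)) + (1ℚ + fromℕ n) * trace H
  ≡⟨ cong (λ x → x * (h₀ - h₁) + (R + (x * h₁ - t)) + x * trace H) (sym (fromℕ-suc n)) ⟩
    N₁ * (h₀ - h₁) + (R + (N₁ * h₁ - t)) + N₁ * trace H
  ≡⟨ cong (λ x → N₁ * (h₀ - h₁) + (R + x) + N₁ * trace H) (sym (λ₁-expansion (tail H))) ⟩
    N₁ * (h₀ - h₁) + (R + inSimpleRoots (λ₁-coeff n) (tail H)) + N₁ * trace H
  ≡⟨ cong (λ x → N₁ * (h₀ - h₁) + x + N₁ * trace H) (sym (inSimpleRoots-+ (ρ-coeff n) (λ₁-coeff n) (tail H))) ⟩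
    inSimpleRoots (ρ-coeff (suc n)) H + N₁ * trace H ∎
  where
  open ≡-Reasoning
  N₁ h₀ h₁ t R : ℚ
  N₁ = fromℕ (suc n)
  h₀ = H F.zero
  h₁ = H (F.suc F.zero)
  t = trace (tail H)
  R = inSimpleRoots (ρ-coeff n) (tail H)

λ₁-coeff-≥1 : ∀ n (i : Fin n) → 1ℚ Q.≤ λ₁-coeff n i
λ₁-coeff-≥1 (suc n) F.zero = fromℕ-suc-≥1 n
λ₁-coeff-≥1 (suc n) (F.suc i) = λ₁-coeff-≥1 n i

ρ-coeff-≥n : ∀ n (i : Fin n) → fromℕ n Q.≤ ρ-coeff n i
ρ-coeff-≥n (suc n) F.zero = QP.≤-refl
ρ-coeff-≥n (suc n) (F.suc i) = subst (Q._≤ ρ-coeff n i + λ₁-coeff n i) (trans (QP.+-comm (fromℕ n) 1ℚ) (sym (fromℕ-suc n)))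
  (QP.+-mono-≤ (ρ-coeff-≥n n i) (λ₁-coeff-≥1 n i))

-- Positivity of fundamental weights on the closed Weyl chamber

InChamber : ∀ {n} → Diag n → Set
InChamber H = ∀ i → 0ℚ Q.≤ α i H

OffSomeWall : ∀ {n} → Diag n → Set
OffSomeWall H = ∃ (λ j → 0ℚ Q.< α j H)

entries-antitone : ∀ {n} (H : Diag n) → InChamber H → ∀ (a b : Fin (suc n)) → toℕ a N.≤ toℕ b → H b Q.≤ H a
entries-antitone H _ F.zero F.zero _ = QP.≤-refl
entries-antitone {zero} H _ F.zero (F.suc ()) _
entries-antitone {suc n} H chamber F.zero (F.suc b) _ =
  QP.≤-trans (entries-antitone (tail H) (λ i → chamber (F.suc i)) F.zero b z≤n) (0≤y-x⇒x≤y _ _ (chamber F.zero))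
entries-antitone {zero} H _ (F.suc ()) _ _
entries-antitone {suc n} H chamber (F.suc a) (F.suc b) (s≤s a≤b) = entries-antitone (tail H) (λ i → chamber (F.suc i)) a b a≤b

-- a traceless element of the chamber off some wall has negative last entry:
-- otherwise all entries are ≥ 0 and h_j = α_j(H) + h_{j+1} > 0 makes the trace positive
last-entry-neg : ∀ {n} (H : Diag n) → trace H ≡ 0ℚ → InChamber H → OffSomeWall H → H (F.fromℕ n) Q.< 0ℚ
last-entry-neg {n} H traceless chamber (j , 0<αj) with H (F.fromℕ n) QP.<? 0ℚ
... | yes last<0 = last<0
... | no last≮0 = ⊥-elim (QP.<-irrefl (sym traceless) (sumFin-pos H entries-nonneg (inject₁ j) 0<hj))
  where
  entries-nonneg : ∀ k → 0ℚ Q.≤ H k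
  entries-nonneg k = QP.≤-trans (QP.≮⇒≥ last≮0)
    (entries-antitone H chamber k (F.fromℕ n) (subst (toℕ k N.≤_) (sym (FP.toℕ-fromℕ n)) (FP.toℕ≤pred[n] k)))
  hj≡ : H (inject₁ j) ≡ α j H + H (F.suc j)
  hj≡ = solve 2 (λ x y → x := (x :- y) :+ y) refl (H (inject₁ j)) (H (F.suc j))
  0<hj : 0ℚ Q.< H (inject₁ j)
  0<hj = subst (0ℚ Q.<_) (sym hj≡) (QP.+-mono-<-≤ 0<αj (entries-nonneg (F.suc j)))

-- the positions 0,…,i summed in λfund i, so that λfund i H = Σ_k restrict (upTo i) H k
upTo : ∀ {n} → Fin n → Fin (suc n) → Bool
upTo i k = toℕ k N.≤ᵇ toℕ i

upTo-index : ∀ {n} (i : Fin n) k → T (upTo i k) → toℕ k N.≤ toℕ i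
upTo-index i k = NP.≤ᵇ⇒≤ (toℕ k) (toℕ i)

not-upTo-index : ∀ {n} (i : Fin n) k → T (not (upTo i k)) → toℕ (F.suc i) N.≤ toℕ k
not-upTo-index i k k>i with upTo i k in eq
... | false = NP.≰⇒> (λ k≤i → subst T eq (NP.≤⇒≤ᵇ k≤i))

last-not-upTo : ∀ {n} (i : Fin n) → T (not (upTo i (F.fromℕ n)))
last-not-upTo {n} i with upTo i (F.fromℕ n) in eq
... | true = NP.<⇒≱ (FP.toℕ<n i) (subst (N._≤ toℕ i) (FP.toℕ-fromℕ n) (upTo-index i (F.fromℕ n) (subst T (sym eq) tt)))
... | false = tt

-- λ_{i+1}(H) = h₁ + … + h_{i+1} > 0.  If h_{i+2} > 0 all summands are positive;
-- otherwise the omitted entries h_{i+2},…,h_{n+1} are ≤ 0 with the last one < 0,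
-- and λ_{i+1}(H) is minus their sum since H is traceless.
λfund-pos : ∀ {n} (H : Diag n) → trace H ≡ 0ℚ → InChamber H → OffSomeWall H → ∀ i → 0ℚ Q.< λfund i H
λfund-pos {n} H traceless chamber offWall i with 0ℚ QP.<? H (F.suc i)
... | yes 0<next = sumFin-pos (restrict (upTo i) H) (restrict-nonneg (upTo i) H included-pos) F.zero
                     (QP.<-≤-trans 0<next (entries-antitone H chamber F.zero (F.suc i) z≤n))
  where
  included-pos : ∀ k → T (upTo i k) → 0ℚ Q.≤ H k
  included-pos k k≤i = QP.<⇒≤ (QP.<-≤-trans 0<next
    (entries-antitone H chamber k (F.suc i) (NP.m≤n⇒m≤1+n (upTo-index i k k≤i))))
... | no 0≮next = subst (0ℚ Q.<_) (sym λ≡-rest) (QP.neg-antimono-< rest<0)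
  where
  excluded : Fin (suc n) → Bool
  excluded k = not (upTo i k)
  excluded-nonpos : ∀ k → T (excluded k) → H k Q.≤ 0ℚ
  excluded-nonpos k k>i = QP.≤-trans (entries-antitone H chamber (F.suc i) k (not-upTo-index i k k>i)) (QP.≮⇒≥ 0≮next)
  rest<0 : sumFin (restrict excluded H) Q.< 0ℚ
  rest<0 = sumFin-neg (restrict excluded H) (restrict-nonpos excluded H excluded-nonpos) (F.fromℕ n)
    (subst (Q._< 0ℚ) (sym (restrict-selected excluded H (F.fromℕ n) (last-not-upTo i)))
           (last-entry-neg H traceless chamber offWall))
  λ≡-rest : λfund i H ≡ - sumFin (restrict excluded H)
  λ≡-rest = trans (solve 2 (λ s c → s := (s :+ c) :- c) refl (λfund i H) (sumFin (restrict excluded H)))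
                  (trans (cong (_- sumFin (restrict excluded H)) (trans (sumFin-restrict (upTo i) H) traceless))
                         (QP.+-identityˡ _))

weight-pos : ∀ {n} (H : Diag n) → (∀ i → 0ℚ Q.< λfund i H) → (q : Fin n → ℕ) → ∃ (λ i → q i ≢ 0) → 0ℚ Q.< weight q H
weight-pos H λ>0 q (i₀ , qi₀≢0) =
  sumFin-pos _ (λ i → *-nonneg (fromℕ-nonneg (q i)) (QP.<⇒≤ (λ>0 i))) i₀ (*-pos (fromℕ-pos (q i₀) qi₀≢0) (λ>0 i₀))

-- Evaluation at an element of the dual basis (α_i(H) = δ_ij)

IsDual : ∀ {n} → Diag n → Fin n → Set
IsDual H j = ∀ i → α i H ≡ δ i j

inSimpleRoots-dual : ∀ {n} (c : Fin n → ℚ) (H : Diag n) j → IsDual H j → inSimpleRoots c H ≡ c j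
inSimpleRoots-dual c H j dual = trans (sumFin-cong (λ i → cong (c i *_) (dual i))) (sumFin-δ c j)

-- β(β̃_j) = 1, so ψ(β̃_j) = 2ρ(β̃_j) - ½
ψ-dual : ∀ {n} (H : Diag n) j → IsDual H j → ψ H ≡ twoρ H - ½
ψ-dual H j dual = cong (λ b → twoρ H - b) (trans (cong (½ *_) β≡1) (QP.*-identityʳ ½))
  where
  β≡1 : β H ≡ 1ℚ
  β≡1 = trans (sumFin-cong (λ i → sym (QP.*-identityˡ (α i H)))) (inSimpleRoots-dual (λ _ → 1ℚ) H j dual)

twoρ-dual : ∀ {n} (H : Diag n) j → trace H ≡ 0ℚ → IsDual H j → twoρ H ≡ ρ-coeff n j
twoρ-dual {n} H j traceless dual = begin
  twoρ H                                            ≡⟨ twoρ-expansion H ⟩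
  inSimpleRoots (ρ-coeff n) H + fromℕ n * trace H   ≡⟨ cong₂ (λ x y → x + fromℕ n * y) (inSimpleRoots-dual (ρ-coeff n) H j dual) traceless ⟩
  ρ-coeff n j + fromℕ n * 0ℚ                        ≡⟨ solve 2 (λ c a → c :+ a :* con 0ℚ := c) refl (ρ-coeff n j) (fromℕ n) ⟩
  ρ-coeff n j                                       ∎
  where open ≡-Reasoning

dual-inChamber : ∀ {n} (H : Diag n) j → IsDual H j → InChamber H
dual-inChamber H j dual i = subst (0ℚ Q.≤_) (sym (dual i)) (δ-nonneg i j)

dual-offWall : ∀ {n} (H : Diag n) j → IsDual H j → OffSomeWall H
dual-offWall H j dual = j , subst (0ℚ Q.<_) (sym (trans (dual j) (δ-refl j))) (QP.positive⁻¹ 1ℚ)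

-- The ratio of the two minima

ratio-bound : ∀ {a c p u u′} → 0ℚ Q.< u′ → u′ * p Q.≤ a → a ≡ u * c → p Q.≤ (u ÷₀ u′) * c
ratio-bound {a} {c} {p} {u} {u′} 0<u′ u′p≤a a≡uc =
  QP.*-cancelˡ-≤-pos u′ {{Q.positive 0<u′}} (subst (u′ * p Q.≤_) a≡u′rc u′p≤a)
  where
  open ≡-Reasoning
  a≡u′rc : a ≡ u′ * ((u ÷₀ u′) * c)
  a≡u′rc = begin
    a                        ≡⟨ a≡uc ⟩
    u * c                    ≡⟨ cong (_* c) (sym (÷₀-cancel u u′ 0<u′)) ⟩
    ((u ÷₀ u′) * u′) * c     ≡⟨ solve 3 (λ r v c → (r :* v) :* c := v :* (r :* c)) refl (u ÷₀ u′) u′ c ⟩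
    u′ * ((u ÷₀ u′) * c)     ∎

half-gap : ∀ {N c r} → 0ℚ Q.≤ N → N Q.≤ c → c - ½ Q.≤ r * c → fromℕ 2 * N * (1ℚ - r) Q.≤ 1ℚ
half-gap {N} {c} {r} 0≤N N≤c c-½≤rc with (1ℚ - r) QP.≤? 0ℚ
... | yes 1-r≤0 = QP.≤-trans (subst (fromℕ 2 * N * (1ℚ - r) Q.≤_) (QP.*-zeroʳ (fromℕ 2 * N))
                               (QP.*-monoˡ-≤-nonNeg (fromℕ 2 * N) {{Q.nonNegative 0≤2N}} 1-r≤0))
                             (QP.nonNegative⁻¹ 1ℚ)
  where
  0≤2N : 0ℚ Q.≤ fromℕ 2 * N
  0≤2N = *-nonneg (fromℕ-nonneg 2) 0≤N
... | no 1-r≰0 = QP.≤-trans (QP.*-monoʳ-≤-nonNeg (1ℚ - r) {{Q.nonNegative (QP.<⇒≤ (QP.≰⇒> 1-r≰0))}} 2N≤2c)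
                            (0≤y-x⇒x≤y _ _ (subst (0ℚ Q.≤_) (sym gap≡) (*-nonneg (fromℕ-nonneg 2) (x≤y⇒0≤y-x _ _ c-½≤rc))))
  where
  2N≤2c : fromℕ 2 * N Q.≤ fromℕ 2 * c
  2N≤2c = QP.*-monoˡ-≤-nonNeg (fromℕ 2) {{Q.nonNegative (fromℕ-nonneg 2)}} N≤c
  gap≡ : 1ℚ - fromℕ 2 * c * (1ℚ - r) ≡ fromℕ 2 * (r * c - (c - ½))
  gap≡ = solve 2 (λ c r → con 1ℚ :- con (fromℕ 2) :* c :* (con 1ℚ :- r) := con (fromℕ 2) :* (r :* c :- (c :- con ½))) refl c r

-- With A > 0, P = C - ½ and 1 ≤ N ≤ C:  2N(1 - min(A/C)/min(A/P)) ≤ 1.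
-- The first minimum is attained at some j₀; there min(A/P)·P_{j₀} ≤ A_{j₀} = min(A/C)·C_{j₀}.
ratio-of-minima : ∀ {n} (A C P : Fin (suc n) → ℚ) (N : ℚ) →
  (∀ j → 0ℚ Q.< A j) → (∀ j → P j ≡ C j - ½) → 1ℚ Q.≤ N → (∀ j → N Q.≤ C j) →
  fromℕ 2 * N * (1ℚ - minFin (λ j → A j ÷₀ C j) ÷₀ minFin (λ j → A j ÷₀ P j)) Q.≤ 1ℚ
ratio-of-minima A C P N 0<A P≡C-½ 1≤N N≤C with minFin-attained (λ j → A j ÷₀ C j) | minFin-attained (λ j → A j ÷₀ P j)
... | j₀ , u≡ | k₀ , u′≡ = half-gap {r = r} 0≤N (N≤C j₀) (subst (Q._≤ r * C j₀) (P≡C-½ j₀) (ratio-bound 0<u′ u′P≤A A≡uC))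
  where
  r : ℚ
  r = minFin (λ j → A j ÷₀ C j) ÷₀ minFin (λ j → A j ÷₀ P j)
  0≤N : 0ℚ Q.≤ N
  0≤N = QP.≤-trans (QP.nonNegative⁻¹ 1ℚ) 1≤N
  0<C : ∀ j → 0ℚ Q.< C j
  0<C j = QP.<-≤-trans (QP.positive⁻¹ 1ℚ) (QP.≤-trans 1≤N (N≤C j))
  0<P : ∀ j → 0ℚ Q.< P j
  0<P j = subst (0ℚ Q.<_) (sym (P≡C-½ j)) (1≤x⇒0<x-½ (C j) (QP.≤-trans 1≤N (N≤C j)))
  0<u′ : 0ℚ Q.< minFin (λ j → A j ÷₀ P j)
  0<u′ = subst (0ℚ Q.<_) (sym u′≡) (÷₀-pos (A k₀) (P k₀) (0<A k₀) (0<P k₀))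
  u′P≤A : minFin (λ j → A j ÷₀ P j) * P j₀ Q.≤ A j₀
  u′P≤A = subst (minFin (λ j → A j ÷₀ P j) * P j₀ Q.≤_) (÷₀-cancel (A j₀) (P j₀) (0<P j₀))
    (QP.*-monoʳ-≤-nonNeg (P j₀) {{Q.nonNegative (QP.<⇒≤ (0<P j₀))}} (minFin-≤ (λ j → A j ÷₀ P j) j₀))
  A≡uC : A j₀ ≡ minFin (λ j → A j ÷₀ C j) * C j₀
  A≡uC = trans (sym (÷₀-cancel (A j₀) (C j₀) (0<C j₀))) (cong (_* C j₀) (sym u≡))

κ₀-nonneg : ∀ n → 0ℚ Q.≤ κ₀ n
κ₀-nonneg n = ÷₀-nonneg 1ℚ _ (QP.nonNegative⁻¹ 1ℚ) (fromℕ-nonneg (n N.* suc n N.* suc (suc n)))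

-- The proposition: κ = 2n(1 - m₁/m₁′)·κ₀, and the bracket 2n(1 - m₁/m₁′) is at most 1
-- by the ratio-of-minima estimate applied to A = λ(β̃_·), C = 2ρ(β̃_·), P = ψ(β̃_·), N = n
-- (of the hypothesis 2 ≤ n only n ≥ 1 is needed).
proposition7 : (n : ℕ) → 2 ≤ n →
    (q : Fin n → ℕ) → ∃ (λ i → q i ≢ 0) →
    (βt : Fin n → Diag n) →
    (∀ j → trace (βt j) ≡ 0ℚ) →
    (∀ i j → α i (βt j) ≡ δ i j) →
    κ n q βt ℚ.≤ κ₀ n
proposition7 n@(suc m) (s≤s _) q λ≢0 βt traceless dual =
  subst (κ n q βt Q.≤_) (QP.*-identityˡ (κ₀ n)) (QP.*-monoʳ-≤-nonNeg (κ₀ n) {{Q.nonNegative (κ₀-nonneg n)}} 2n[1-m₁/m₁′]≤1)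
  where
  dualⱼ : ∀ j → IsDual (βt j) j
  dualⱼ j i = dual i j
  0<λ : ∀ j → 0ℚ Q.< weight q (βt j)
  0<λ j = weight-pos (βt j) (λfund-pos (βt j) (traceless j) (dual-inChamber (βt j) j (dualⱼ j)) (dual-offWall (βt j) j (dualⱼ j))) q λ≢0
  n≤2ρ : ∀ j → fromℕ n Q.≤ twoρ (βt j)
  n≤2ρ j = subst (fromℕ n Q.≤_) (sym (twoρ-dual (βt j) j (traceless j) (dualⱼ j))) (ρ-coeff-≥n n j)
  2n[1-m₁/m₁′]≤1 : fromℕ (2 N.* n) * (1ℚ - m₁ q βt ÷₀ m₁′ q βt) Q.≤ 1ℚ
  2n[1-m₁/m₁′]≤1 = subst (λ x → x * (1ℚ - m₁ q βt ÷₀ m₁′ q βt) Q.≤ 1ℚ) (sym (fromℕ-* 2 n))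
    (ratio-of-minima (λ j → weight q (βt j)) (λ j → twoρ (βt j)) (λ j → ψ (βt j)) (fromℕ n)
      0<λ (λ j → ψ-dual (βt j) j (dualⱼ j)) (fromℕ-suc-≥1 m) n≤2ρ)
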